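{- Let $(G,\sigma)$ be a qBMG with vertex set $L$ such that $|\sigma(L)|=\ell<|L|$. Then there is a proper vertex coloring $\sigma'$ of $G$ with $|\sigma'(L)|=\ell+1$ such that $(G,\sigma')$ is a qBMG.
   Context: Digraphs are finite and simple; a coloring is proper if equally colored vertices are non-adjacent. All rooted trees are phylogenetic; $v\preceq_T u$ means $u$ is on the path from the root $\rho_T$ to $v$; $\mathrm{lca}_T$ is the least common ancestor. In a leaf-colored tree $(T,\sigma)$, leaf $y$ is a best match of leaf $x$ if $\sigma(x)\ne\sigma(y)$ and $\mathrm{lca}_T(x,y)\preceq_T\mathrm{lca}_T(x,y')$ for all leaves $y'$ with $\sigma(y')=\sigma(y)$. A truncation map $u\colon L(T)\times S\to V(T)$ (with $\sigma(L(T))\subseteq S$) sends $(x,s)$ to a vertex on the path from $\rho_T$ to $x$, with $u(x,\sigma(x))=x$; $y$ is a quasi-best match of $x$ if it is a best match and $\mathrm{lca}_T(x,y)\preceq_T u(x,\sigma(y))$. A vertex-colored digraph is a qBMG if it equals the digraph on $L(T)$ with coloring $\sigma$ and arcs $xy$ for quasi-best matches $y$ of $x$, for some $(T,\sigma,u)$. -}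

module Defs where

open import Data.Nat using (ℕ; suc)
open import Data.Fin using (Fin)
open import Data.Maybe using (Maybe; just; nothing)
open import Data.Bool using (Bool; true)
open import Data.Product using (Σ; ∃; _×_; _,_)
open import Relation.Binary.PropositionalEquality using (_≡_; _≢_)
open import Relation.Nullary using (¬_)
open import Function.Bundles using (_⇔_)
open import Function.Definitions using (Injective)

record Digraph (n : ℕ) : Set where
  field
    arc      : Fin n → Fin n → Bool
    loopless : ∀ x → ¬ (arc x x ≡ true)
open Digraph public

Coloring : ℕ → Set
Coloring n = Fin n → ℕ

-- |σ(L)| = ℓ : the image of σ is enumerated without repetition by Fin ℓ.
ImageSize : ∀ {n} → Coloring n → ℕ → Set
ImageSize {n} σ ℓ =
  Σ (Fin ℓ → ℕ) λ f → Injective _≡_ _≡_ f ×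
    (∀ c → (∃ λ (x : Fin n) → σ x ≡ c) ⇔ (∃ λ (i : Fin ℓ) → f i ≡ c))

Proper : ∀ {n} → Digraph n → Coloring n → Set
Proper G σ' = ∀ x y → arc G x y ≡ true → σ' x ≢ σ' y

-- Rooted trees given by a parent function on vertices Fin m.
-- v ⪯ u  (u lies on the path from the root to v).

data Below {m : ℕ} (parent : Fin m → Maybe (Fin m)) : Fin m → Fin m → Set where
  here : ∀ {v} → Below parent v v
  up   : ∀ {v w u} → parent v ≡ just w → Below parent w u → Below parent v u

record Tree (n : ℕ) : Set where
  field
    m          : ℕ
    parent     : Fin m → Maybe (Fin m)
    root       : Fin m
    root-top   : parent root ≡ nothing
    other-has-parent : ∀ v → parent v ≡ nothing → v ≡ root
    reach-root : ∀ v → Below parent v root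
    phylo      : ∀ v → (∃ λ w → parent w ≡ just v) →
                 Σ (Fin m) λ w₁ → Σ (Fin m) λ w₂ →
                   w₁ ≢ w₂ × parent w₁ ≡ just v × parent w₂ ≡ just v
    leaf       : Fin n → Fin m
    leaf-inj   : Injective _≡_ _≡_ leaf
    leaf-leaf  : ∀ x w → ¬ (parent w ≡ just (leaf x))
    leaf-onto  : ∀ v → (∀ w → ¬ (parent w ≡ just v)) → ∃ λ x → leaf x ≡ v
open Tree public

module _ {n : ℕ} (T : Tree n) where

  _⪯_ : Fin (m T) → Fin (m T) → Set
  v ⪯ u = Below (parent T) v u

  IsLCA : Fin (m T) → Fin (m T) → Fin (m T) → Set
  IsLCA a b w = a ⪯ w × b ⪯ w × (∀ z → a ⪯ z → b ⪯ z → w ⪯ z)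

  -- truncation map u : L × S → V(T); colors S are taken to be all of ℕ
  record Truncation (σ : Coloring n) : Set where
    field
      tr      : Fin n → ℕ → Fin (m T)
      tr-path : ∀ x s → leaf T x ⪯ tr x s
      tr-own  : ∀ x → tr x (σ x) ≡ leaf T x
  open Truncation public

  BestMatch : Coloring n → Fin n → Fin n → Set
  BestMatch σ x y =
    σ x ≢ σ y ×
    (∀ y' → σ y' ≡ σ y → ∀ w w' →
       IsLCA (leaf T x) (leaf T y) w → IsLCA (leaf T x) (leaf T y') w' → w ⪯ w')

  QuasiBestMatch : (σ : Coloring n) → Truncation σ → Fin n → Fin n → Set
  QuasiBestMatch σ u x y =
    BestMatch σ x y ×
    (∀ w → IsLCA (leaf T x) (leaf T y) w → w ⪯ tr u x (σ y))

IsQBMG : ∀ {n} → Digraph n → Coloring n → Set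
IsQBMG {n} G σ =
  Σ (Tree n) λ T → Σ (Truncation T σ) λ u →
    ∀ x y → (arc G x y ≡ true) ⇔ QuasiBestMatch T σ u x y

module Submission where

-- Two leaves x ≠ x' share a colour s by pigeonhole; giving x a fresh colour c enlarges the image by
-- one.  The tree stays the same and only the truncation map changes: colour c (carried by x alone,
-- so x is always a best match) is kept at z iff z → x is an arc, and colour s is kept at z only if
-- z still has an s-coloured out-neighbour other than x.  Elsewhere the colour is truncated at the
-- leaf z itself, which rules out every quasi-best match of that colour.

open import Defs
open import Data.Nat using (ℕ; suc; _<_)
import Data.Nat as ℕ
import Data.Nat.Properties as ℕ
open import Data.Bool using (Bool; true; false; if_then_else_)
import Data.Bool as Bool
open import Data.Bool.Properties using (¬-not)
open import Data.Fin using (Fin; zero; suc)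
open import Data.Fin.Properties using (_≟_; any?; pigeonhole)
import Data.Fin.Properties as Fin
open import Data.List using (tabulate)
open import Data.List.Extrema.Nat using (max; xs≤max)
import Data.List.Relation.Unary.All as All
open import Data.List.Membership.Propositional.Properties using (∈-tabulate⁺)
open import Data.Maybe using (just)
open import Data.Maybe.Properties using (just-injective)
open import Data.Product using (Σ; _×_; ∃; ∃₂; _,_; proj₁; proj₂)
open import Data.Vec.Functional using (updateAt; _∷_)
open import Data.Vec.Functional.Properties using (updateAt-updates; updateAt-minimal)
open import Function using (_∘_; const)
open import Function.Bundles using (_⇔_; mk⇔; Equivalence)
import Function.Properties.Equivalence as ⇔
open import Function.Definitions using (Injective)
open import Relation.Nullary using (¬_; Dec; yes; no; does; ¬?; _×-dec_; contradiction)
open import Relation.Nullary.Decidable using (map′)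
open import Relation.Unary using (Decidable)
open import Relation.Binary.PropositionalEquality

module TreeProperties {n : ℕ} (T : Tree n) where

  infix 4 _⪯ᵀ_
  _⪯ᵀ_ : Fin (m T) → Fin (m T) → Set
  _⪯ᵀ_ = _⪯_ T

  ⪯-trans : ∀ {a b c} → a ⪯ᵀ b → b ⪯ᵀ c → a ⪯ᵀ c
  ⪯-trans here     q = q
  ⪯-trans (up e p) q = up e (⪯-trans p q)

  ⪯-leaf : ∀ {v x} → v ⪯ᵀ leaf T x → v ≡ leaf T x
  ⪯-leaf here = refl
  ⪯-leaf {v} {x} (up e p) with ⪯-leaf p
  ... | refl = contradiction e (leaf-leaf T x v)

  root-⪯ : ∀ {v} → root T ⪯ᵀ v → v ≡ root T
  root-⪯ here = refl
  root-⪯ (up e _) with trans (sym (root-top T)) e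
  ... | ()

  ⪯-parent : ∀ {a a' z} → parent T a ≡ just a' → a ≢ z → a ⪯ᵀ z → a' ⪯ᵀ z
  ⪯-parent e a≢z here         = contradiction refl a≢z
  ⪯-parent e a≢z (up e' a'⪯z) = subst (_⪯ᵀ _) (just-injective (trans (sym e') e)) a'⪯z

  ⪯-dec-from : ∀ {b} → b ⪯ᵀ root T → ∀ v → Dec (b ⪯ᵀ v)
  ⪯-dec-from here v with v ≟ root T
  ... | yes refl  = yes here
  ... | no v≢root = no (v≢root ∘ root-⪯)
  ⪯-dec-from {b} (up e p) v with b ≟ v
  ... | yes refl = yes here
  ... | no b≢v   = map′ (up e) (⪯-parent e b≢v) (⪯-dec-from p v)

  ⪯-dec : ∀ b v → Dec (b ⪯ᵀ v)
  ⪯-dec b = ⪯-dec-from (reach-root T b)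

  lca-from : ∀ {a} b → a ⪯ᵀ root T → Σ (Fin (m T)) (IsLCA T a b)
  lca-from {a} b here = a , here , reach-root T b , λ _ a⪯z _ → a⪯z
  lca-from {a} b (up e p) with ⪯-dec b a
  ... | yes b⪯a = a , here , b⪯a , λ _ a⪯z _ → a⪯z
  ... | no b⋠a with lca-from b p
  ...   | w , a'⪯w , b⪯w , least =
    w , up e a'⪯w , b⪯w , λ z a⪯z b⪯z → least z (⪯-parent e (λ { refl → b⋠a b⪯z }) a⪯z) b⪯z

  lca : ∀ a b → Σ (Fin (m T)) (IsLCA T a b)
  lca a b = lca-from b (reach-root T a)

  lca⪯leaf⇒≡ : ∀ {x y w} → IsLCA T (leaf T x) (leaf T y) w → w ⪯ᵀ leaf T x → x ≡ y
  lca⪯leaf⇒≡ (_ , y⪯w , _) w⪯x = sym (leaf-inj T (⪯-leaf (⪯-trans y⪯w w⪯x)))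

module _ {n : ℕ} (T : Tree n) where

  open TreeProperties T

  bestMatch-transfer : ∀ {τ₁ τ₂ : Coloring n} {z y} →
    (∀ v → τ₂ v ≡ τ₂ y → τ₁ v ≡ τ₁ y) → BestMatch T τ₁ z y → BestMatch T τ₂ z y
  bestMatch-transfer {z = z} shrinks (τz≢τy , least) =
    τz≢τy ∘ shrinks z , λ y' → least y' ∘ shrinks y'

  quasiBestMatch-transfer : ∀ {τ₁ τ₂ : Coloring n} (u₁ : Truncation T τ₁) (u₂ : Truncation T τ₂) {z y} →
    (∀ v → τ₂ v ≡ τ₂ y → τ₁ v ≡ τ₁ y) → tr u₁ z (τ₁ y) ≡ tr u₂ z (τ₂ y) →
    QuasiBestMatch T τ₁ u₁ z y → QuasiBestMatch T τ₂ u₂ z y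
  quasiBestMatch-transfer _ _ shrinks same-tr (bm , below) =
    bestMatch-transfer shrinks bm , λ w isLCA → subst (_⪯ᵀ_ w) same-tr (below w isLCA)

  quasiBestMatch-leaf : ∀ {σ : Coloring n} (u : Truncation T σ) {z y} →
    tr u z (σ y) ≡ leaf T z → ¬ QuasiBestMatch T σ u z y
  quasiBestMatch-leaf {σ} _ {z} {y} tr≡leaf ((σz≢σy , _) , below) =
    let w , isLCA = lca (leaf T z) (leaf T y) in
    σz≢σy (cong σ (lca⪯leaf⇒≡ isLCA (subst (_⪯ᵀ_ w) tr≡leaf (below w isLCA))))

qbmg-proper : ∀ {n} {G : Digraph n} {σ : Coloring n} → IsQBMG G σ → Proper G σ
qbmg-proper (_ , _ , explains) z y a = proj₁ (proj₁ (Equivalence.to (explains z y) a))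

fresh-colour : ∀ {n} (σ : Coloring n) → ∃ λ c → ∀ z → σ z ≢ c
fresh-colour σ =
  suc (max 0 (tabulate σ)) , λ z → ℕ.<⇒≢ (ℕ.s≤s (All.lookup (xs≤max 0 (tabulate σ)) (∈-tabulate⁺ z)))

imageSize-collision : ∀ {n ℓ} {σ : Coloring n} → ImageSize σ ℓ → ℓ < n →
  ∃₂ λ x x' → x ≢ x' × σ x ≡ σ x'
imageSize-collision {n} {ℓ} {σ} (f , _ , image) ℓ<n =
  let i , j , i<j , same-index = pigeonhole ℓ<n index in
  i , j , Fin.<⇒≢ i<j , trans (sym (indexed i)) (trans (cong f same-index) (indexed j))
  where
  index : Fin n → Fin ℓ
  index z = proj₁ (Equivalence.to (image (σ z)) (z , refl))
  indexed : ∀ z → f (index z) ≡ σ z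
  indexed z = proj₂ (Equivalence.to (image (σ z)) (z , refl))

module Recoloring {n : ℕ} (σ : Coloring n) (x : Fin n) (c : ℕ) (c-fresh : ∀ z → σ z ≢ c) where

  s : ℕ
  s = σ x

  s≢c : s ≢ c
  s≢c = c-fresh x

  σ' : Coloring n
  σ' = updateAt σ x (const c)

  σ'-x : σ' x ≡ c
  σ'-x = updateAt-updates x σ

  σ'-≢x : ∀ {z} → z ≢ x → σ' z ≡ σ z
  σ'-≢x {z} = updateAt-minimal z x σ

  σ'≡c⇒≡x : ∀ {z} → σ' z ≡ c → z ≡ x
  σ'≡c⇒≡x {z} σ'z≡c with z ≟ x
  ... | yes z≡x = z≡x
  ... | no z≢x  = contradiction (trans (sym (σ'-≢x z≢x)) σ'z≡c) (c-fresh z)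

  σ'≡⇒σ≡ : ∀ {z t} → t ≢ c → σ' z ≡ t → σ z ≡ t
  σ'≡⇒σ≡ {z} t≢c σ'z≡t with z ≟ x
  ... | yes refl = contradiction (trans (sym σ'z≡t) σ'-x) t≢c
  ... | no z≢x   = trans (sym (σ'-≢x z≢x)) σ'z≡t

  σ≡⇒σ'≡ : ∀ {z t} → t ≢ s → σ z ≡ t → σ' z ≡ t
  σ≡⇒σ'≡ {z} t≢s σz≡t with z ≟ x
  ... | yes refl = contradiction (sym σz≡t) t≢s
  ... | no z≢x   = trans (σ'-≢x z≢x) σz≡t

  σ'-class⊆σ-class : ∀ {y v} → y ≢ x → σ' v ≡ σ' y → σ v ≡ σ y
  σ'-class⊆σ-class {y} y≢x σ'v≡σ'y = σ'≡⇒σ≡ (c-fresh y) (trans σ'v≡σ'y (σ'-≢x y≢x))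

  imageSize-recolor : ∀ {ℓ x'} → ImageSize σ ℓ → x ≢ x' → σ x ≡ σ x' → ImageSize σ' (suc ℓ)
  imageSize-recolor {ℓ} {x'} (f , f-inj , image) x≢x' σx≡σx' = c ∷ f , c∷f-inj , image'
    where
    f≢c : ∀ i → f i ≢ c
    f≢c i = let z , σz≡fi = Equivalence.from (image (f i)) (i , refl) in c-fresh z ∘ trans σz≡fi

    c∷f-inj : Injective _≡_ _≡_ (c ∷ f)
    c∷f-inj {zero}  {zero}  _ = refl
    c∷f-inj {zero}  {suc j} e = contradiction (sym e) (f≢c j)
    c∷f-inj {suc i} {zero}  e = contradiction e (f≢c i)
    c∷f-inj {suc i} {suc j} e = cong suc (f-inj e)

    σ'-hits : ∀ {t} → (∃ λ z → σ z ≡ t) → ∃ λ z → σ' z ≡ t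
    σ'-hits (z , σz≡t) with z ≟ x
    ... | yes refl = x' , trans (σ'-≢x (x≢x' ∘ sym)) (trans (sym σx≡σx') σz≡t)
    ... | no z≢x   = z , trans (σ'-≢x z≢x) σz≡t

    image' : ∀ t → (∃ λ z → σ' z ≡ t) ⇔ (∃ λ i → (c ∷ f) i ≡ t)
    image' t = mk⇔ to from
      where
      to : (∃ λ z → σ' z ≡ t) → ∃ λ i → (c ∷ f) i ≡ t
      to (z , σ'z≡t) with z ≟ x
      ... | yes refl = zero , trans (sym σ'-x) σ'z≡t
      ... | no z≢x   = let i , fi≡t = Equivalence.to (image t) (z , trans (sym (σ'-≢x z≢x)) σ'z≡t)
                       in suc i , fi≡t
      from : (∃ λ i → (c ∷ f) i ≡ t) → ∃ λ z → σ' z ≡ t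
      from (zero  , c≡t)  = x , trans σ'-x c≡t
      from (suc i , fi≡t) = σ'-hits (Equivalence.from (image t) (i , fi≡t))

  module Explained (G : Digraph n) (T : Tree n) (u : Truncation T σ)
    (explains : ∀ z y → (arc G z y ≡ true) ⇔ QuasiBestMatch T σ u z y) where

    open TreeProperties T

    σ-proper : Proper G σ
    σ-proper = qbmg-proper {G = G} (T , u , explains)

    HasOtherArc : Fin n → Set
    HasOtherArc z = ∃ λ y → y ≢ x × σ y ≡ s × arc G z y ≡ true

    hasOtherArc? : Decidable HasOtherArc
    hasOtherArc? z = any? λ y → ¬? (y ≟ x) ×-dec (σ y ℕ.≟ s) ×-dec (arc G z y Bool.≟ true)

    hasOtherArc⇒σ≢s : ∀ {z} → HasOtherArc z → σ z ≢ s
    hasOtherArc⇒σ≢s {z} (y , _ , σy≡s , a) σz≡s = σ-proper z y a (trans σz≡s (sym σy≡s))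

    keepIf : Bool → Fin n → Fin (m T) → Fin (m T)
    keepIf b z v = if b then v else leaf T z

    keepIf-path : ∀ b {z v} → leaf T z ⪯ᵀ v → leaf T z ⪯ᵀ keepIf b z v
    keepIf-path true  z⪯v = z⪯v
    keepIf-path false _   = here

    tr' : Fin n → ℕ → Fin (m T)
    tr' z t with t ℕ.≟ c | t ℕ.≟ s
    ... | yes _ | _     = keepIf (arc G z x) z (root T)
    ... | no _  | yes _ = keepIf (does (hasOtherArc? z)) z (tr u z s)
    ... | no _  | no _  = tr u z t

    tr'-c : ∀ z → tr' z c ≡ keepIf (arc G z x) z (root T)
    tr'-c z with c ℕ.≟ c | c ℕ.≟ s
    ... | yes _  | _ = refl
    ... | no c≢c | _ = contradiction refl c≢c

    tr'-s : ∀ z → tr' z s ≡ keepIf (does (hasOtherArc? z)) z (tr u z s)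
    tr'-s z with s ℕ.≟ c | s ℕ.≟ s
    ... | yes s≡c | _      = contradiction s≡c s≢c
    ... | no _    | yes _  = refl
    ... | no _    | no s≢s = contradiction refl s≢s

    tr'-other : ∀ z {t} → t ≢ c → t ≢ s → tr' z t ≡ tr u z t
    tr'-other z {t} t≢c t≢s with t ℕ.≟ c | t ℕ.≟ s
    ... | yes t≡c | _       = contradiction t≡c t≢c
    ... | no _    | yes t≡s = contradiction t≡s t≢s
    ... | no _    | no _    = refl

    tr'-s-kept : ∀ {z} → HasOtherArc z → tr' z s ≡ tr u z s
    tr'-s-kept {z} e with hasOtherArc? z | tr'-s z
    ... | yes _ | eq = eq
    ... | no ¬e | _  = contradiction e ¬e

    tr'-s-cut : ∀ {z} → ¬ HasOtherArc z → tr' z s ≡ leaf T z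
    tr'-s-cut {z} ¬e with hasOtherArc? z | tr'-s z
    ... | yes e | _  = contradiction e ¬e
    ... | no _  | eq = eq

    tr'-path : ∀ z t → leaf T z ⪯ᵀ tr' z t
    tr'-path z t with t ℕ.≟ c | t ℕ.≟ s
    ... | yes _ | _     = keepIf-path (arc G z x) (reach-root T (leaf T z))
    ... | no _  | yes _ = keepIf-path (does (hasOtherArc? z)) (tr-path u z s)
    ... | no _  | no _  = tr-path u z t

    tr'-σ : ∀ z → tr' z (σ z) ≡ leaf T z
    tr'-σ z = by-colour (σ z ℕ.≟ s)
      where
      by-colour : Dec (σ z ≡ s) → tr' z (σ z) ≡ leaf T z
      by-colour (yes σz≡s) = trans (cong (tr' z) σz≡s) (tr'-s-cut λ e → hasOtherArc⇒σ≢s e σz≡s)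
      by-colour (no σz≢s)  = trans (tr'-other z (c-fresh z) σz≢s) (tr-own u z)

    tr'-own : ∀ z → tr' z (σ' z) ≡ leaf T z
    tr'-own z with z ≟ x
    ... | no z≢x   = trans (cong (tr' z) (σ'-≢x z≢x)) (tr'-σ z)
    ... | yes refl = begin
      tr' x (σ' x)                  ≡⟨ cong (tr' x) σ'-x ⟩
      tr' x c                       ≡⟨ tr'-c x ⟩
      keepIf (arc G x x) x (root T) ≡⟨ cong (λ b → keepIf b x (root T)) (¬-not (loopless G x)) ⟩
      leaf T x                      ∎
      where open ≡-Reasoning

    u' : Truncation T σ'
    u' = record { tr = tr' ; tr-path = tr'-path ; tr-own = tr'-own }

    tr'-σ'x : ∀ z {b} → arc G z x ≡ b → tr' z (σ' x) ≡ keepIf b z (root T)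
    tr'-σ'x z refl = trans (cong (tr' z) σ'-x) (tr'-c z)

    tr'-σ' : ∀ z {y} → y ≢ x → tr' z (σ' y) ≡ tr' z (σ y)
    tr'-σ' z y≢x = cong (tr' z) (σ'-≢x y≢x)

    bestMatch-x : ∀ {z} → z ≢ x → BestMatch T σ' z x
    bestMatch-x {z} z≢x = (λ σ'z≡σ'x → z≢x (σ'≡c⇒≡x (trans σ'z≡σ'x σ'-x))) , only-x
      where
      only-x : ∀ y' → σ' y' ≡ σ' x → ∀ w w' →
        IsLCA T (leaf T z) (leaf T x) w → IsLCA T (leaf T z) (leaf T y') w' → w ⪯ᵀ w'
      only-x y' σ'y'≡σ'x w w' (_ , _ , least) (z⪯w' , y'⪯w' , _) with σ'≡c⇒≡x (trans σ'y'≡σ'x σ'-x)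
      ... | refl = least w' z⪯w' y'⪯w'

    arc-to-x : ∀ z → (arc G z x ≡ true) ⇔ QuasiBestMatch T σ' u' z x
    arc-to-x z = mk⇔ to from
      where
      to : arc G z x ≡ true → QuasiBestMatch T σ' u' z x
      to a = bestMatch-x (λ { refl → loopless G z a })
           , λ w _ → subst (w ⪯ᵀ_) (sym (tr'-σ'x z a)) (reach-root T w)
      from : QuasiBestMatch T σ' u' z x → arc G z x ≡ true
      from q with arc G z x in a
      ... | true  = refl
      ... | false = contradiction q (quasiBestMatch-leaf T u' (tr'-σ'x z a))

    untouched-class : ∀ z {y} → y ≢ x → σ y ≢ s →
      QuasiBestMatch T σ u z y ⇔ QuasiBestMatch T σ' u' z y
    untouched-class z {y} y≢x σy≢s = mk⇔
      (quasiBestMatch-transfer T u u' (λ _ → σ'-class⊆σ-class y≢x) (sym same-tr))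
      (quasiBestMatch-transfer T u' u (λ _ σv≡σy → trans (σ≡⇒σ'≡ σy≢s σv≡σy) (sym (σ'-≢x y≢x))) same-tr)
      where
      same-tr : tr' z (σ' y) ≡ tr u z (σ y)
      same-tr = trans (tr'-σ' z y≢x) (tr'-other z (c-fresh y) σy≢s)

    old-class-kept : ∀ {z y} → y ≢ x → σ y ≡ s → HasOtherArc z →
      QuasiBestMatch T σ u z y ⇔ QuasiBestMatch T σ' u' z y
    old-class-kept {z} {y} y≢x σy≡s other@(y₀ , y₀≢x , σy₀≡s , a₀) =
      mk⇔ (quasiBestMatch-transfer T u u' (λ _ → σ'-class⊆σ-class y≢x) (sym same-tr)) regained
      where
      same-tr : tr' z (σ' y) ≡ tr u z (σ y)
      same-tr = begin
        tr' z (σ' y)   ≡⟨ tr'-σ' z y≢x ⟩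
        tr' z (σ y)    ≡⟨ cong (tr' z) σy≡s ⟩
        tr' z s        ≡⟨ tr'-s-kept other ⟩
        tr u z s       ≡⟨ cong (tr u z) σy≡s ⟨
        tr u z (σ y)   ∎
        where open ≡-Reasoning

      regained : QuasiBestMatch T σ' u' z y → QuasiBestMatch T σ u z y
      regained ((_ , least') , below') =
        (σz≢σy , least) , λ w isLCA → subst (w ⪯ᵀ_) same-tr (below' w isLCA)
        where
        σz≢σy : σ z ≢ σ y
        σz≢σy σz≡σy = hasOtherArc⇒σ≢s other (trans σz≡σy σy≡s)

        -- y is at least as close to z as y₀, which as a best match of z is at least as close as
        -- every leaf of colour s, x included.
        least : ∀ y' → σ y' ≡ σ y → ∀ w w' → IsLCA T (leaf T z) (leaf T y) w →
                IsLCA T (leaf T z) (leaf T y') w' → w ⪯ᵀ w'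
        least y' σy'≡σy w w' isW isW' =
          let w₀ , isW₀    = lca (leaf T z) (leaf T y₀)
              _ , y₀-least = proj₁ (Equivalence.to (explains z y₀) a₀)
              σ'y₀≡σ'y     = trans (σ'-≢x y₀≢x) (trans σy₀≡s (sym (trans (σ'-≢x y≢x) σy≡s)))
              σy'≡σy₀      = trans σy'≡σy (trans σy≡s (sym σy₀≡s))
          in ⪯-trans (least' y₀ σ'y₀≡σ'y w w₀ isW isW₀) (y₀-least y' σy'≡σy₀ w₀ w' isW₀ isW')

    old-class-cut : ∀ {z y} → y ≢ x → σ y ≡ s → ¬ HasOtherArc z →
      (arc G z y ≡ true) ⇔ QuasiBestMatch T σ' u' z y
    old-class-cut {z} {y} y≢x σy≡s none = mk⇔
      (λ a → contradiction (y , y≢x , σy≡s , a) none)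
      (λ q → contradiction q (quasiBestMatch-leaf T u' cut))
      where
      cut : tr' z (σ' y) ≡ leaf T z
      cut = trans (tr'-σ' z y≢x) (trans (cong (tr' z) σy≡s) (tr'-s-cut none))

    explains' : ∀ z y → (arc G z y ≡ true) ⇔ QuasiBestMatch T σ' u' z y
    explains' z y with y ≟ x
    ... | yes refl = arc-to-x z
    ... | no y≢x with σ y ℕ.≟ s
    ...   | no σy≢s = ⇔.trans (explains z y) (untouched-class z y≢x σy≢s)
    ...   | yes σy≡s with hasOtherArc? z
    ...     | yes other = ⇔.trans (explains z y) (old-class-kept y≢x σy≡s other)
    ...     | no none   = old-class-cut y≢x σy≡s none

    qbmg' : IsQBMG G σ'
    qbmg' = T , u' , explains'

proposition4 : ∀ (n : ℕ) (G : Digraph n) (σ : Coloring n) (ℓ : ℕ) →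
    IsQBMG G σ → ImageSize σ ℓ → ℓ < n →
    Σ (Coloring n) λ σ' → Proper G σ' × ImageSize σ' (suc ℓ) × IsQBMG G σ'
proposition4 n G σ ℓ (T , u , explains) image ℓ<n =
  let x , x' , x≢x' , σx≡σx' = imageSize-collision image ℓ<n
      c , c-fresh = fresh-colour σ
      open Recoloring σ x c c-fresh
      open Explained G T u explains
  in σ' , qbmg-proper {G = G} qbmg' , imageSize-recolor image x≢x' σx≡σx' , qbmg'
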